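{- For all strictly positive formulas $\varphi,\psi$: if $\varphi\vdash_{\mathbf{RC}}\psi$, then $\mathscr{T}(\varphi)\hookrightarrow^{*}\mathscr{T}(\psi)$ in the tree rewriting system $\mathsf{TRC}$.
   Context: Strictly positive formulas $\mathcal{L}^+$: $\varphi::=\top\mid p\mid\langle\alpha\rangle\varphi\mid(\varphi\wedge\varphi)$ with $p$ a propositional variable and $\alpha<\omega$. $\mathbf{K}^+$ has axioms $\varphi\vdash\varphi$, $\varphi\vdash\top$, $\varphi\wedge\psi\vdash\varphi$, $\varphi\wedge\psi\vdash\psi$, and rules: from $\varphi\vdash\psi$ and $\psi\vdash\chi$ infer $\varphi\vdash\chi$; from $\varphi\vdash\psi$ and $\varphi\vdash\chi$ infer $\varphi\vdash\psi\wedge\chi$; from $\varphi\vdash\psi$ infer $\langle\alpha\rangle\varphi\vdash\langle\alpha\rangle\psi$. $\mathbf{RC}$ extends $\mathbf{K}^+$ by axioms $\langle\alpha\rangle\langle\alpha\rangle\varphi\vdash\langle\alpha\rangle\varphi$; $\langle\alpha\rangle\varphi\vdash\langle\beta\rangle\varphi$ for $\alpha>\beta$; $\langle\alpha\rangle\varphi\wedge\langle\beta\rangle\psi\vdash\langle\alpha\rangle(\varphi\wedge\langle\beta\rangle\psi)$ for $\alpha>\beta$. Modal trees: recursively, pairs $\langle\Delta;\Gamma\rangle$ with $\Delta$ a finite list of propositional variables and $\Gamma$ a finite list of pairs $(\alpha,\mathtt{S})$, $\alpha<\omega$, $\mathtt{S}$ a modal tree. Sum: $\langle\Delta_1;\Gamma_1\rangle+\langle\Delta_2;\Gamma_2\rangle=\langle\Delta_1\frown\Delta_2;\Gamma_1\frown\Gamma_2\rangle$.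 Embedding $\mathscr{T}$: $\mathscr{T}(\top)=\langle\varnothing;\varnothing\rangle$, $\mathscr{T}(p)=\langle[p];\varnothing\rangle$, $\mathscr{T}(\langle\alpha\rangle\varphi)=\langle\varnothing;[(\alpha,\mathscr{T}(\varphi))]\rangle$, $\mathscr{T}(\varphi\wedge\psi)=\mathscr{T}(\varphi)+\mathscr{T}(\psi)$. Positions: $\mathrm{Pos}(\langle\Delta;\varnothing\rangle)=\{\epsilon\}$; $\mathrm{Pos}(\langle\Delta;[(\alpha_1,\mathtt{S}_1),\dots,(\alpha_n,\mathtt{S}_n)]\rangle)=\{\epsilon\}\cup\bigcup_{i=1}^n\{i\mathbf{k}\mid\mathbf{k}\in\mathrm{Pos}(\mathtt{S}_i)\}$. Subtree: $\mathtt{T}|_\epsilon=\mathtt{T}$, $\mathtt{T}|_{i\mathbf{r}}=\mathtt{S}_i|_{\mathbf{r}}$. Replacement: $\mathtt{T}[\mathtt{S}]_\epsilon=\mathtt{S}$, $\mathtt{T}[\mathtt{S}]_{i\mathbf{r}}$ is $\mathtt{T}$ with its $i$-th child $\mathtt{S}_i$ replaced by $\mathtt{S}_i[\mathtt{S}]_{\mathbf{r}}$ (same edge label). List operations, for $0<i,j\le|\Gamma|$: $\#_i\Gamma$ is the $i$-th element; $\Gamma^{ -i}$ deletes it; $\Gamma^{+i}=(\#_i\Gamma)\frown\Gamma$; $\Gamma[x]_i$ replaces the $i$-th element by $x$; $\Gamma^{i\leftrightarrow j}$ swaps the $i$-th and $j$-th elements; similarly $\Delta^{ -n},\Delta^{+n}$.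 $\mathsf{TRC}$ rules: for a modal tree $\mathtt{T}$, $\mathbf{k}\in\mathrm{Pos}(\mathtt{T})$ with $\mathtt{T}|_\mathbf{k}=\langle\Delta;\Gamma\rangle$: ($\rho^+$) $\mathtt{T}\hookrightarrow\mathtt{T}[\langle\Delta^{+i};\Gamma\rangle]_\mathbf{k}$, $0<i\le|\Delta|$; ($\rho^-$) $\mathtt{T}\hookrightarrow\mathtt{T}[\langle\Delta^{ -i};\Gamma\rangle]_\mathbf{k}$; ($\sigma$) $\mathtt{T}\hookrightarrow\mathtt{T}[\langle\Delta;\Gamma^{i\leftrightarrow j}\rangle]_\mathbf{k}$, $i\neq j$; ($\pi^+$) $\mathtt{T}\hookrightarrow\mathtt{T}[\langle\Delta;\Gamma^{+i}\rangle]_\mathbf{k}$; ($\pi^-$) $\mathtt{T}\hookrightarrow\mathtt{T}[\langle\Delta;\Gamma^{ -i}\rangle]_\mathbf{k}$; ($\mathfrak{4}$) if $\#_i\Gamma=(\beta,\langle\tilde\Delta;\tilde\Gamma\rangle)$ and $\#_j\tilde\Gamma=(\beta,\mathtt{S})$, then $\mathtt{T}\hookrightarrow\mathtt{T}[\langle\Delta;\Gamma[(\beta,\mathtt{S})]_i\rangle]_\mathbf{k}$; ($\lambda$) if $\#_i\Gamma=(\alpha,\mathtt{S})$ and $\alpha>\beta$, then $\mathtt{T}\hookrightarrow\mathtt{T}[\langle\Delta;\Gamma[(\beta,\mathtt{S})]_i\rangle]_\mathbf{k}$; ($\mathsf{J}$) if $i\ne j$, $\#_i\Gamma=(\alpha,\langle\tilde\Delta;\tilde\Gamma\rangle)$,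 $\#_j\Gamma=(\beta,\mathtt{S})$, $\alpha>\beta$, then $\mathtt{T}\hookrightarrow\mathtt{T}[\langle\Delta;(\Gamma[(\alpha,\langle\tilde\Delta;\tilde\Gamma\frown(\beta,\mathtt{S})\rangle)]_i)^{ -j}\rangle]_\mathbf{k}$. $\hookrightarrow$ is the union of these relations and $\hookrightarrow^*$ its reflexive-transitive closure. -}

module Defs where

open import Data.Nat using (ℕ; zero; suc; _<_)
open import Data.List using (List; []; _∷_; _++_; [_])
open import Data.Maybe using (Maybe; just; nothing)
open import Data.Product using (_×_; _,_; ∃; ∃-syntax)
open import Relation.Binary.PropositionalEquality using (_≡_)
open import Relation.Binary.Construct.Closure.ReflexiveTransitive using (Star)
open import Relation.Nullary using (¬_)

-- Propositional variables are natural numbers; modal indices α < ω are naturals.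
Var : Set
Var = ℕ

infixr 6 _∧_
data Fm : Set where
  ⊤    : Fm
  var  : Var → Fm
  ⟨_⟩_ : ℕ → Fm → Fm
  _∧_  : Fm → Fm → Fm

infix 4 _⊢_
data _⊢_ : Fm → Fm → Set where
  ax-id    : ∀ {φ} → φ ⊢ φ
  ax-top   : ∀ {φ} → φ ⊢ ⊤
  ax-∧l    : ∀ {φ ψ} → φ ∧ ψ ⊢ φ
  ax-∧r    : ∀ {φ ψ} → φ ∧ ψ ⊢ ψ
  cut      : ∀ {φ ψ χ} → φ ⊢ ψ → ψ ⊢ χ → φ ⊢ χ
  ∧-intro  : ∀ {φ ψ χ} → φ ⊢ ψ → φ ⊢ χ → φ ⊢ ψ ∧ χ
  nec      : ∀ {α φ ψ} → φ ⊢ ψ → ⟨ α ⟩ φ ⊢ ⟨ α ⟩ ψ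
  ax-4     : ∀ {α φ} → ⟨ α ⟩ ⟨ α ⟩ φ ⊢ ⟨ α ⟩ φ
  ax-mono  : ∀ {α β φ} → β < α → ⟨ α ⟩ φ ⊢ ⟨ β ⟩ φ
  ax-J     : ∀ {α β φ ψ} → β < α →
             ⟨ α ⟩ φ ∧ ⟨ β ⟩ ψ ⊢ ⟨ α ⟩ (φ ∧ ⟨ β ⟩ ψ)

data Tree : Set where
  node : List Var → List (ℕ × Tree) → Tree

_+T_ : Tree → Tree → Tree
node Δ₁ Γ₁ +T node Δ₂ Γ₂ = node (Δ₁ ++ Δ₂) (Γ₁ ++ Γ₂)

𝒯 : Fm → Tree
𝒯 ⊤          = node [] []
𝒯 (var p)    = node [ p ] []
𝒯 (⟨ α ⟩ φ)  = node [] [ (α , 𝒯 φ) ]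
𝒯 (φ ∧ ψ)    = 𝒯 φ +T 𝒯 ψ

-- 1-based list operations (index i valid iff 0 < i ≤ length)

nth : ∀ {A : Set} → List A → ℕ → Maybe A
nth []       _             = nothing
nth (x ∷ xs) zero          = nothing
nth (x ∷ xs) (suc zero)    = just x
nth (x ∷ xs) (suc (suc n)) = nth xs (suc n)

delAt : ∀ {A : Set} → List A → ℕ → List A
delAt []       _             = []
delAt (x ∷ xs) zero          = x ∷ xs
delAt (x ∷ xs) (suc zero)    = xs
delAt (x ∷ xs) (suc (suc n)) = x ∷ delAt xs (suc n)

setAt : ∀ {A : Set} → List A → ℕ → A → List A
setAt []       _             y = []
setAt (x ∷ xs) zero          y = x ∷ xs
setAt (x ∷ xs) (suc zero)    y = y ∷ xs
setAt (x ∷ xs) (suc (suc n)) y = x ∷ setAt xs (suc n) y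

-- Positions (lists of 1-based child indices), subtrees, replacement

mutual
  -- T|_k  (just S iff k ∈ Pos(T) and T|_k = S)
  subtree : Tree → List ℕ → Maybe Tree
  subtree T []                 = just T
  subtree (node Δ Γ) (i ∷ r)   = subtreeL Γ i r

  subtreeL : List (ℕ × Tree) → ℕ → List ℕ → Maybe Tree
  subtreeL []            _             r = nothing
  subtreeL (x ∷ Γ)       zero          r = nothing
  subtreeL ((α , S) ∷ Γ) (suc zero)    r = subtree S r
  subtreeL (x ∷ Γ)       (suc (suc n)) r = subtreeL Γ (suc n) r

mutual
  replace : Tree → Tree → List ℕ → Tree
  replace T S []               = S
  replace (node Δ Γ) S (i ∷ r) = node Δ (replaceL Γ S i r)

  replaceL : List (ℕ × Tree) → Tree → ℕ → List ℕ → List (ℕ × Tree)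
  replaceL []            S _             r = []
  replaceL (x ∷ Γ)       S zero          r = x ∷ Γ
  replaceL ((α , T) ∷ Γ) S (suc zero)    r = (α , replace T S r) ∷ Γ
  replaceL (x ∷ Γ)       S (suc (suc n)) r = x ∷ replaceL Γ S (suc n) r

data Local : List Var → List (ℕ × Tree) → Tree → Set where
  ρ⁺ : ∀ {Δ Γ i p} → nth Δ i ≡ just p → Local Δ Γ (node (p ∷ Δ) Γ)
  ρ⁻ : ∀ {Δ Γ i p} → nth Δ i ≡ just p → Local Δ Γ (node (delAt Δ i) Γ)
  σ  : ∀ {Δ Γ i j x y} → ¬ i ≡ j → nth Γ i ≡ just x → nth Γ j ≡ just y →
       Local Δ Γ (node Δ (setAt (setAt Γ i y) j x))
  π⁺ : ∀ {Δ Γ i x} → nth Γ i ≡ just x → Local Δ Γ (node Δ (x ∷ Γ))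
  π⁻ : ∀ {Δ Γ i x} → nth Γ i ≡ just x → Local Δ Γ (node Δ (delAt Γ i))
  r4 : ∀ {Δ Γ i j β Δ̃ Γ̃ S} →
       nth Γ i ≡ just (β , node Δ̃ Γ̃) → nth Γ̃ j ≡ just (β , S) →
       Local Δ Γ (node Δ (setAt Γ i (β , S)))
  λr : ∀ {Δ Γ i α β S} → nth Γ i ≡ just (α , S) → β < α →
       Local Δ Γ (node Δ (setAt Γ i (β , S)))
  J  : ∀ {Δ Γ i j α β Δ̃ Γ̃ S} → ¬ i ≡ j →
       nth Γ i ≡ just (α , node Δ̃ Γ̃) → nth Γ j ≡ just (β , S) → β < α →
       Local Δ Γ (node Δ (delAt (setAt Γ i (α , node Δ̃ (Γ̃ ++ [ (β , S) ]))) j))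

infix 4 _↪_ _↪*_
_↪_ : Tree → Tree → Set
T ↪ T' = ∃[ k ] ∃[ Δ ] ∃[ Γ ] ∃[ N ]
           (subtree T k ≡ just (node Δ Γ) × Local Δ Γ N × T' ≡ replace T N k)

_↪*_ : Tree → Tree → Set
_↪*_ = Star _↪_

{-# OPTIONS --safe #-}
module Submission where

-- The axioms 4, monotonicity and J of RC are
-- single TRC steps at the root. Everything else only rearranges the lists Δ
-- and Γ of nodes: copying an element to the front (ρ⁺, π⁺) and deleting one
-- (ρ⁻, π⁻) turn a list L into any list whose elements occur in L, which gives
-- ∧-elimination, ⊤-introduction, T ↪* T +T T and commutativity of +T. A
-- derivation lifts below a diamond by prefixing its positions with 1, and into
-- the left summand of T +T U since appending to a list keeps the positions of
-- T; commutativity then gives ∧-introduction.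

open import Defs
open import Data.Nat using (ℕ; zero; suc; _<_)
open import Data.List using (List; []; _∷_; _++_; [_]; length)
open import Data.List.Properties using (++-identityʳ)
open import Data.List.Membership.Propositional using (_∈_)
open import Data.List.Membership.Propositional.Properties using (∈-++⁺ʳ)
open import Data.List.Relation.Unary.Any using (here; there)
open import Data.List.Relation.Binary.Subset.Propositional using (_⊆_)
open import Data.List.Relation.Binary.Subset.Propositional.Properties
  using (⊆-refl; ⊆-reflexive-↭; xs⊆xs++ys; xs⊆ys++xs)
open import Data.List.Relation.Binary.Permutation.Propositional.Properties using (++-comm)
open import Data.Maybe using (just)
open import Data.Product using (_×_; _,_; ∃-syntax; proj₂; map)
open import Function using (_∘_; id)
open import Relation.Binary.PropositionalEquality using (_≡_; refl; sym; trans; cong; subst)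
open import Relation.Binary.Construct.Closure.ReflexiveTransitive using (Star; ε; _◅_; _◅◅_)

private
  variable
    A : Set
    x y : A
    xs L M : List A
    Δ Δ' : List Var
    Γ Γ' Γ₁ : List (ℕ × Tree)
    T T' U V N : Tree

infix 4 _⇝_ _⇝*_

data _⇝_ {A : Set} (L : List A) : List A → Set where
  copy   : ∀ {i x} → nth L i ≡ just x → L ⇝ x ∷ L
  delete : ∀ {i x} → nth L i ≡ just x → L ⇝ delAt L i

_⇝*_ : List A → List A → Set
_⇝*_ = Star _⇝_

∈⇒nth : x ∈ L → ∃[ k ] nth L (suc k) ≡ just x
∈⇒nth (here refl)   = 0 , refl
∈⇒nth (there x∈L) = map suc id (∈⇒nth x∈L)

nth-++-length : ∀ (xs : List A) y L → nth (xs ++ y ∷ L) (suc (length xs)) ≡ just y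
nth-++-length []       y L = refl
nth-++-length (x ∷ xs) y L = nth-++-length xs y L

delAt-++-length : ∀ (xs : List A) y L → delAt (xs ++ y ∷ L) (suc (length xs)) ≡ xs ++ L
delAt-++-length []       y L = refl
delAt-++-length (x ∷ xs) y L = cong (x ∷_) (delAt-++-length xs y L)

⇝*-prepend : ∀ M → M ⊆ L → L ⇝* M ++ L
⇝*-prepend []      M⊆L = ε
⇝*-prepend (m ∷ M) M⊆L =
  ⇝*-prepend M (M⊆L ∘ there) ◅◅ copy (proj₂ (∈⇒nth (∈-++⁺ʳ M (M⊆L (here refl))))) ◅ ε

⇝*-dropSuffix : ∀ (xs ys : List A) → xs ++ ys ⇝* xs
⇝*-dropSuffix xs [] = subst (_⇝* xs) (sym (++-identityʳ xs)) ε
⇝*-dropSuffix xs (y ∷ ys) =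
  subst (xs ++ y ∷ ys ⇝_) (delAt-++-length xs y ys) (delete (nth-++-length xs y ys))
  ◅ ⇝*-dropSuffix xs ys

⇝*-⊆ : M ⊆ L → L ⇝* M
⇝*-⊆ {M = M} {L = L} M⊆L = ⇝*-prepend M M⊆L ◅◅ ⇝*-dropSuffix M L

↪-root : Local Δ Γ N → node Δ Γ ↪ N
↪-root step = [] , _ , _ , _ , refl , step , refl

↪*-node : Δ ⇝* Δ' → Γ ⇝* Γ' → node Δ Γ ↪* node Δ' Γ'
↪*-node (copy eq ◅ Δ⇝*) Γ⇝*   = ↪-root (ρ⁺ eq) ◅ ↪*-node Δ⇝* Γ⇝*
↪*-node (delete eq ◅ Δ⇝*) Γ⇝* = ↪-root (ρ⁻ eq) ◅ ↪*-node Δ⇝* Γ⇝*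
↪*-node ε (copy eq ◅ Γ⇝*)     = ↪-root (π⁺ eq) ◅ ↪*-node ε Γ⇝*
↪*-node ε (delete eq ◅ Γ⇝*)   = ↪-root (π⁻ eq) ◅ ↪*-node ε Γ⇝*
↪*-node ε ε                   = ε

+T-diag : ∀ T → T ↪* T +T T
+T-diag (node Δ Γ) = ↪*-node (⇝*-prepend Δ ⊆-refl) (⇝*-prepend Γ ⊆-refl)

+T-comm : ∀ T U → T +T U ↪* U +T T
+T-comm (node Δ₁ Γ₁) (node Δ₂ Γ₂) =
  ↪*-node (⇝*-⊆ (⊆-reflexive-↭ (++-comm Δ₂ Δ₁))) (⇝*-⊆ (⊆-reflexive-↭ (++-comm Γ₂ Γ₁)))

+T-projˡ : ∀ T U → T +T U ↪* T
+T-projˡ (node Δ₁ Γ₁) (node Δ₂ Γ₂) = ↪*-node (⇝*-⊆ (xs⊆xs++ys Δ₁ Δ₂)) (⇝*-⊆ (xs⊆xs++ys Γ₁ Γ₂))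

+T-projʳ : ∀ T U → T +T U ↪* U
+T-projʳ (node Δ₁ Γ₁) (node Δ₂ Γ₂) = ↪*-node (⇝*-⊆ (xs⊆ys++xs Δ₂ Δ₁)) (⇝*-⊆ (xs⊆ys++xs Γ₂ Γ₁))

↪*-empty : ∀ T → T ↪* node [] []
↪*-empty (node Δ Γ) = ↪*-node (⇝*-⊆ (λ ())) (⇝*-⊆ (λ ()))

J-root : ∀ {α β} T U → β < α →
         node [] ((α , T) ∷ (β , U) ∷ []) ↪ node [] [ (α , T +T node [] [ (β , U) ]) ]
J-root {α} {β} (node Δ Γ) U β<α =
  [] , _ , _ , _ , refl , J {i = 1} {j = 2} (λ ()) refl refl β<α ,
  cong (λ Δ' → node [] [ (α , node Δ' (Γ ++ [ (β , U) ])) ]) (++-identityʳ Δ)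

data InRange {A : Set} : List A → ℕ → Set where
  first : InRange (x ∷ xs) 1
  next  : ∀ {n} → InRange xs (suc n) → InRange (x ∷ xs) (suc (suc n))

nth⇒InRange : ∀ L i → nth L i ≡ just x → InRange L i
nth⇒InRange (_ ∷ _)     (suc zero)    _  = first
nth⇒InRange (_ ∷ _ ∷ _) (suc (suc i)) eq = next (nth⇒InRange _ (suc i) eq)

subtreeL⇒InRange : ∀ {i r} → subtreeL Γ i r ≡ just T → InRange Γ i
subtreeL⇒InRange {Γ = _ ∷ _}     {i = suc zero}    _  = first
subtreeL⇒InRange {Γ = _ ∷ _ ∷ _} {i = suc (suc _)} eq = next (subtreeL⇒InRange eq)

InRange-setAt : ∀ {i j} → InRange xs i → InRange (setAt xs j y) i
InRange-setAt {j = zero}        first    = first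
InRange-setAt {j = zero}        (next r) = next r
InRange-setAt {j = suc zero}    first    = first
InRange-setAt {j = suc zero}    (next r) = next r
InRange-setAt {j = suc (suc _)} first    = first
InRange-setAt {j = suc (suc _)} (next r) = next (InRange-setAt r)

module _ (ys : List A) where

  nth-++ˡ : ∀ {i} → InRange xs i → nth (xs ++ ys) i ≡ nth xs i
  nth-++ˡ first    = refl
  nth-++ˡ (next r) = nth-++ˡ r

  setAt-++ˡ : ∀ {i} → InRange xs i → setAt (xs ++ ys) i y ≡ setAt xs i y ++ ys
  setAt-++ˡ first    = refl
  setAt-++ˡ (next r) = cong (_ ∷_) (setAt-++ˡ r)

  delAt-++ˡ : ∀ {i} → InRange xs i → delAt (xs ++ ys) i ≡ delAt xs i ++ ys
  delAt-++ˡ first    = refl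
  delAt-++ˡ (next r) = cong (_ ∷_) (delAt-++ˡ r)

module _ (Γ₂ : List (ℕ × Tree)) where

  subtreeL-++ˡ : ∀ {i} r → InRange Γ₁ i → subtreeL (Γ₁ ++ Γ₂) i r ≡ subtreeL Γ₁ i r
  subtreeL-++ˡ {Γ₁ = _ ∷ _} r first    = refl
  subtreeL-++ˡ              r (next k) = subtreeL-++ˡ r k

  replaceL-++ˡ : ∀ {i} r → InRange Γ₁ i → replaceL (Γ₁ ++ Γ₂) N i r ≡ replaceL Γ₁ N i r ++ Γ₂
  replaceL-++ˡ {Γ₁ = _ ∷ _} r first    = refl
  replaceL-++ˡ              r (next k) = cong (_ ∷_) (replaceL-++ˡ r k)

nth-++ˡ-just : ∀ xs ys i → nth xs i ≡ just x → nth (xs ++ ys) i ≡ just x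
nth-++ˡ-just xs ys i eq = trans (nth-++ˡ ys (nth⇒InRange xs i eq)) eq

Local-+T : ∀ Δ₁ Γ₁ Δ₂ Γ₂ → Local Δ₁ Γ₁ N → Local (Δ₁ ++ Δ₂) (Γ₁ ++ Γ₂) (N +T node Δ₂ Γ₂)
Local-+T Δ₁ Γ₁ Δ₂ Γ₂ (ρ⁺ {i = i} eq) = ρ⁺ (nth-++ˡ-just Δ₁ Δ₂ i eq)
Local-+T Δ₁ Γ₁ Δ₂ Γ₂ (ρ⁻ {i = i} eq) =
  subst (Local _ _) (cong (λ Δ → node Δ _) (delAt-++ˡ Δ₂ (nth⇒InRange Δ₁ i eq)))
        (ρ⁻ (nth-++ˡ-just Δ₁ Δ₂ i eq))
Local-+T Δ₁ Γ₁ Δ₂ Γ₂ (σ {i = i} {j} {x} {y} i≢j eqᵢ eqⱼ) =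
  subst (Local _ _) (cong (node _) swapped)
        (σ i≢j (nth-++ˡ-just Γ₁ Γ₂ i eqᵢ) (nth-++ˡ-just Γ₁ Γ₂ j eqⱼ))
  where
  swapped : setAt (setAt (Γ₁ ++ Γ₂) i y) j x ≡ setAt (setAt Γ₁ i y) j x ++ Γ₂
  swapped = trans (cong (λ Γ → setAt Γ j x) (setAt-++ˡ Γ₂ (nth⇒InRange Γ₁ i eqᵢ)))
                  (setAt-++ˡ Γ₂ (InRange-setAt (nth⇒InRange Γ₁ j eqⱼ)))
Local-+T Δ₁ Γ₁ Δ₂ Γ₂ (π⁺ {i = i} eq) = π⁺ (nth-++ˡ-just Γ₁ Γ₂ i eq)
Local-+T Δ₁ Γ₁ Δ₂ Γ₂ (π⁻ {i = i} eq) =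
  subst (Local _ _) (cong (node _) (delAt-++ˡ Γ₂ (nth⇒InRange Γ₁ i eq)))
        (π⁻ (nth-++ˡ-just Γ₁ Γ₂ i eq))
Local-+T Δ₁ Γ₁ Δ₂ Γ₂ (r4 {i = i} eqᵢ eqⱼ) =
  subst (Local _ _) (cong (node _) (setAt-++ˡ Γ₂ (nth⇒InRange Γ₁ i eqᵢ)))
        (r4 (nth-++ˡ-just Γ₁ Γ₂ i eqᵢ) eqⱼ)
Local-+T Δ₁ Γ₁ Δ₂ Γ₂ (λr {i = i} eq β<α) =
  subst (Local _ _) (cong (node _) (setAt-++ˡ Γ₂ (nth⇒InRange Γ₁ i eq)))
        (λr (nth-++ˡ-just Γ₁ Γ₂ i eq) β<α)
Local-+T Δ₁ Γ₁ Δ₂ Γ₂ (J {i = i} {j} {α} {β} {Δ̃} {Γ̃} {S} i≢j eqᵢ eqⱼ β<α) =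
  subst (Local _ _) (cong (node _) joined)
        (J i≢j (nth-++ˡ-just Γ₁ Γ₂ i eqᵢ) (nth-++ˡ-just Γ₁ Γ₂ j eqⱼ) β<α)
  where
  joined : delAt (setAt (Γ₁ ++ Γ₂) i (α , node Δ̃ (Γ̃ ++ [ (β , S) ]))) j
         ≡ delAt (setAt Γ₁ i (α , node Δ̃ (Γ̃ ++ [ (β , S) ]))) j ++ Γ₂
  joined = trans (cong (λ Γ → delAt Γ j) (setAt-++ˡ Γ₂ (nth⇒InRange Γ₁ i eqᵢ)))
                 (delAt-++ˡ Γ₂ (InRange-setAt (nth⇒InRange Γ₁ j eqⱼ)))

+T-congʳ-↪ : ∀ U → T ↪ T' → T +T U ↪ T' +T U
+T-congʳ-↪ {node Δ₁ Γ₁} (node Δ₂ Γ₂) ([] , _ , _ , _ , refl , step , refl) =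
  [] , _ , _ , _ , refl , Local-+T Δ₁ Γ₁ Δ₂ Γ₂ step , refl
+T-congʳ-↪ {node Δ₁ Γ₁} (node Δ₂ Γ₂) (i ∷ r , _ , _ , N , eq , step , refl) =
  i ∷ r , _ , _ , N , trans (subtreeL-++ˡ Γ₂ r k) eq , step ,
  cong (node _) (sym (replaceL-++ˡ Γ₂ r k))
  where
  k : InRange Γ₁ i
  k = subtreeL⇒InRange eq

+T-congʳ : ∀ U → T ↪* T' → T +T U ↪* T' +T U
+T-congʳ U ε            = ε
+T-congʳ U (step ◅ T↪*) = +T-congʳ-↪ U step ◅ +T-congʳ U T↪*

+T-intro : T ↪* U → T ↪* V → T ↪* U +T V
+T-intro {T} {U} {V} T↪*U T↪*V =
  +T-diag T ◅◅ +T-congʳ T T↪*U ◅◅ +T-comm U T ◅◅ +T-congʳ U T↪*V ◅◅ +T-comm V U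

⟨⟩-cong : ∀ α → T ↪* T' → node [] [ (α , T) ] ↪* node [] [ (α , T') ]
⟨⟩-cong α ε = ε
⟨⟩-cong α ((k , _ , _ , _ , eq , step , refl) ◅ T↪*) =
  (1 ∷ k , _ , _ , _ , eq , step , refl) ◅ ⟨⟩-cong α T↪*

mainTheorem2 : ∀ (φ ψ : Fm) → φ ⊢ ψ → 𝒯 φ ↪* 𝒯 ψ
mainTheorem2 φ       _       ax-id                 = ε
mainTheorem2 φ       _       ax-top                = ↪*-empty (𝒯 φ)
mainTheorem2 (φ ∧ ψ) _       ax-∧l                 = +T-projˡ (𝒯 φ) (𝒯 ψ)
mainTheorem2 (φ ∧ ψ) _       ax-∧r                 = +T-projʳ (𝒯 φ) (𝒯 ψ)
mainTheorem2 φ       χ       (cut {ψ = ψ} φ⊢ψ ψ⊢χ) = mainTheorem2 φ ψ φ⊢ψ ◅◅ mainTheorem2 ψ χ ψ⊢χ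
mainTheorem2 φ       (ψ ∧ χ) (∧-intro φ⊢ψ φ⊢χ)     = +T-intro (mainTheorem2 φ ψ φ⊢ψ) (mainTheorem2 φ χ φ⊢χ)
mainTheorem2 (⟨ α ⟩ φ) (⟨ _ ⟩ ψ) (nec φ⊢ψ)         = ⟨⟩-cong α (mainTheorem2 φ ψ φ⊢ψ)
mainTheorem2 _       _       ax-4                  = ↪-root (r4 {i = 1} {j = 1} refl refl) ◅ ε
mainTheorem2 _       _       (ax-mono β<α)         = ↪-root (λr {i = 1} refl β<α) ◅ ε
mainTheorem2 (⟨ α ⟩ φ ∧ ⟨ β ⟩ ψ) _ (ax-J β<α)      = J-root (𝒯 φ) (𝒯 ψ) β<α ◅ ε
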